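{- For all integers $m\ge 2$ and $n\ge 2$, $$\overline{T}(n-1,m)=\sum_{k=0}^{n}(-1)^{n-k}\,\overline{T}(k,m)\,\overline{T}(n-k,m-1).$$
   Context: For a positive integer $m$, $A_m$ is the $m\times m$ matrix with $(i,j)$ entry $1$ if $i+j\le m+1$ and $0$ otherwise, $u_m=(1,\dots,1)^T\in\mathbb{R}^m$, $v_{m,1}$ is the first standard unit column vector of $\mathbb{R}^m$, and $\overline{T}(n,m)=u_m^TA_m^nv_{m,1}$ for $n\in\mathbb{N}$. -}

module Defs where

open import Data.Nat using (ℕ; zero; suc; _+_; _*_; _<ᵇ_)
open import Data.Bool using (if_then_else_)
open import Data.Fin using (Fin; toℕ; zero; suc)
open import Data.Integer as ℤ using (ℤ)

Mat : ℕ → Set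
Mat m = Fin m → Fin m → ℕ

ΣFin : (m : ℕ) → (Fin m → ℕ) → ℕ
ΣFin zero    f = 0
ΣFin (suc m) f = f zero + ΣFin m (λ i → f (suc i))

_⊗_ : {m : ℕ} → Mat m → Mat m → Mat m
_⊗_ {m} A B i j = ΣFin m (λ k → A i k * B k j)

identity : (m : ℕ) → Mat m
identity m i j = if (toℕ i <ᵇ toℕ j) then 0 else (if (toℕ j <ᵇ toℕ i) then 0 else 1)

_^ᴹ_ : {m : ℕ} → Mat m → ℕ → Mat m
_^ᴹ_ {m} A zero    = identity m
_^ᴹ_ {m} A (suc n) = A ⊗ (A ^ᴹ n)

-- A_m : entry (i,j) (1-based) is 1 iff i + j ≤ m + 1;
-- with 0-based indices i' = i-1, j' = j-1 this is i' + j' < m.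
A : (m : ℕ) → Mat m
A m i j = if (toℕ i + toℕ j <ᵇ m) then 1 else 0

-- T̄(n,m) = u_mᵀ A_mⁿ v_{m,1}  = sum of the first column of A_mⁿ
Tbar : ℕ → ℕ → ℕ
Tbar n zero    = 0
Tbar n (suc m) = ΣFin (suc m) (λ i → (A (suc m) ^ᴹ n) i zero)

sign : ℕ → ℤ
sign zero          = ℤ.1ℤ
sign (suc zero)    = ℤ.-1ℤ
sign (suc (suc k)) = sign k

Σℤ≤ : ℕ → (ℕ → ℤ) → ℤ
Σℤ≤ zero    f = f 0
Σℤ≤ (suc n) f = Σℤ≤ n f ℤ.+ f (suc n)

{-# OPTIONS --safe #-}
module Submission where

-- Let c_k be the first column of A_{s+1}^k and d_j that of A_s^j, and let
-- P(k, j) = Σ_{i<s} c_k[s-i] d_j[i] pair c_k, read bottom-up, with d_j.  Since A_m sends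
-- x to the vector of sums (x_0 + … + x_{m-1-i})_i, summation by parts gives
-- T̄(k,s+1) T̄(j,s) = P(k+1, j) + P(k, j+1).  The alternating sum therefore telescopes
-- to P(n+1, 0) ± P(0, n+1); the second term vanishes as c_0 = e_1, and the first is
-- c_{n+1}[s] = c_n[0] = Σ_i c_{n-1}[i] = T̄(n-1, s+1).

open import Defs
open import Data.Nat using (ℕ; _≤_; _∸_)
open import Data.Integer using (ℤ; +_; _*_)
open import Relation.Binary.PropositionalEquality using (_≡_)

open import Data.Bool using (if_then_else_)
open import Data.Fin using (Fin; toℕ; zero; suc)
open import Data.Nat using (zero; suc; _<_; _<ᵇ_; s≤s; z≤n) renaming (_+_ to _+ℕ_; _*_ to _*ℕ_)
import Data.Nat.Properties as ℕ
import Data.Nat.Tactic.RingSolver as ℕ-Solver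
open import Data.Integer using (_+_; -_; 0ℤ; 1ℤ)
import Data.Integer.Tactic.RingSolver as ℤ-Solver
import Data.Integer.Properties as ℤ
open import Relation.Binary.PropositionalEquality using (refl; sym; trans; cong; cong₂; module ≡-Reasoning)

∑< : ℕ → (ℕ → ℕ) → ℕ
∑< zero    f = 0
∑< (suc n) f = f 0 +ℕ ∑< n (λ i → f (suc i))

∑<-init-last : ∀ n f → ∑< (suc n) f ≡ ∑< n f +ℕ f n
∑<-init-last zero    f = ℕ.+-identityʳ (f 0)
∑<-init-last (suc n) f = trans (cong (f 0 +ℕ_) (∑<-init-last n (λ i → f (suc i))))
                               (sym (ℕ.+-assoc (f 0) _ _))

∑<-cong : ∀ n {f g : ℕ → ℕ} → (∀ i → i < n → f i ≡ g i) → ∑< n f ≡ ∑< n g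
∑<-cong zero    f≗g = refl
∑<-cong (suc n) f≗g = cong₂ _+ℕ_ (f≗g 0 (s≤s z≤n)) (∑<-cong n (λ i i<n → f≗g (suc i) (s≤s i<n)))

∑<-zero : ∀ n {f : ℕ → ℕ} → (∀ i → i < n → f i ≡ 0) → ∑< n f ≡ 0
∑<-zero zero    f≗0 = refl
∑<-zero (suc n) f≗0 = cong₂ _+ℕ_ (f≗0 0 (s≤s z≤n)) (∑<-zero n (λ i i<n → f≗0 (suc i) (s≤s i<n)))

suc[m∸1+n]≡m∸n : ∀ m n → n < m → suc (m ∸ suc n) ≡ m ∸ n
suc[m∸1+n]≡m∸n m n n<m = sym (ℕ.+-∸-assoc 1 n<m)

∑<-reverse : ∀ n f → ∑< n f ≡ ∑< n (λ i → f (n ∸ suc i))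
∑<-reverse zero    f = refl
∑<-reverse (suc n) f = begin
  f 0 +ℕ ∑< n (λ i → f (suc i))          ≡⟨ cong (f 0 +ℕ_) (∑<-reverse n (λ i → f (suc i))) ⟩
  f 0 +ℕ ∑< n (λ i → f (suc (n ∸ suc i))) ≡⟨ cong (f 0 +ℕ_) (∑<-cong n (λ i i<n → cong f (suc[m∸1+n]≡m∸n n i i<n))) ⟩
  f 0 +ℕ ∑< n (λ i → f (n ∸ i))          ≡⟨ ℕ.+-comm (f 0) _ ⟩
  ∑< n (λ i → f (n ∸ i)) +ℕ f 0          ≡⟨ cong (λ r → ∑< n (λ i → f (n ∸ i)) +ℕ f r) (sym (ℕ.n∸n≡0 n)) ⟩
  ∑< n (λ i → f (n ∸ i)) +ℕ f (n ∸ n)    ≡⟨ sym (∑<-init-last n (λ i → f (n ∸ i))) ⟩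
  ∑< (suc n) (λ i → f (n ∸ i))           ∎
  where open ≡-Reasoning

∑<-truncate : ∀ n k (x : ℕ → ℕ) → k ≤ n → ∑< n (λ l → (if l <ᵇ k then 1 else 0) *ℕ x l) ≡ ∑< k x
∑<-truncate n       zero    x k≤n       = ∑<-zero n (λ _ _ → refl)
∑<-truncate (suc n) (suc k) x (s≤s k≤n) =
  cong₂ _+ℕ_ (ℕ.*-identityˡ (x 0)) (∑<-truncate n k (λ i → x (suc i)) k≤n)

ΣFin≡∑< : ∀ n (f : ℕ → ℕ) → ΣFin n (λ i → f (toℕ i)) ≡ ∑< n f
ΣFin≡∑< zero    f = refl
ΣFin≡∑< (suc n) f = cong (f 0 +ℕ_) (ΣFin≡∑< n (λ i → f (suc i)))

ΣFin-cong : ∀ n {f g : Fin n → ℕ} → (∀ i → f i ≡ g i) → ΣFin n f ≡ ΣFin n g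
ΣFin-cong zero    f≗g = refl
ΣFin-cong (suc n) f≗g = cong₂ _+ℕ_ (f≗g zero) (ΣFin-cong n (λ i → f≗g (suc i)))

i+l<ᵇm≡l<ᵇm∸i : ∀ i l m → (i +ℕ l <ᵇ m) ≡ (l <ᵇ m ∸ i)
i+l<ᵇm≡l<ᵇm∸i zero    l m       = refl
i+l<ᵇm≡l<ᵇm∸i (suc i) l zero    = refl
i+l<ᵇm≡l<ᵇm∸i (suc i) l (suc m) = i+l<ᵇm≡l<ᵇm∸i i l m

A-row : ∀ m (i : Fin m) (x : ℕ → ℕ) → ΣFin m (λ l → A m i l *ℕ x (toℕ l)) ≡ ∑< (m ∸ toℕ i) x
A-row m i x = begin
  ΣFin m (λ l → A m i l *ℕ x (toℕ l))
    ≡⟨ ΣFin≡∑< m (λ l → (if toℕ i +ℕ l <ᵇ m then 1 else 0) *ℕ x l) ⟩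
  ∑< m (λ l → (if toℕ i +ℕ l <ᵇ m then 1 else 0) *ℕ x l)
    ≡⟨ ∑<-cong m (λ l _ → cong (λ b → (if b then 1 else 0) *ℕ x l) (i+l<ᵇm≡l<ᵇm∸i (toℕ i) l m)) ⟩
  ∑< m (λ l → (if l <ᵇ m ∸ toℕ i then 1 else 0) *ℕ x l)
    ≡⟨ ∑<-truncate m (m ∸ toℕ i) x (ℕ.m∸n≤m m (toℕ i)) ⟩
  ∑< (m ∸ toℕ i) x ∎
  where open ≡-Reasoning

column : ℕ → ℕ → ℕ → ℕ
column m zero    zero    = 1
column m zero    (suc i) = 0
column m (suc k) i       = ∑< (m ∸ i) (column m k)

A^k-firstColumn : ∀ m k (i : Fin (suc m)) → (A (suc m) ^ᴹ k) i zero ≡ column (suc m) k (toℕ i)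
A^k-firstColumn m zero    zero    = refl
A^k-firstColumn m zero    (suc i) = refl
A^k-firstColumn m (suc k) i =
  trans (ΣFin-cong (suc m) (λ l → cong (A (suc m) i l *ℕ_) (A^k-firstColumn m k l)))
        (A-row (suc m) i (column (suc m) k))

Tbar≡∑<column : ∀ m k → Tbar k m ≡ ∑< m (column m k)
Tbar≡∑<column zero    k = refl
Tbar≡∑<column (suc m) k =
  trans (ΣFin-cong (suc m) (A^k-firstColumn m k)) (ΣFin≡∑< (suc m) (column (suc m) k))

∑<-by-parts : ∀ (x y : ℕ → ℕ) s →
  ∑< s (λ i → ∑< (suc i) x *ℕ y i) +ℕ ∑< s (λ i → x (suc i) *ℕ ∑< (suc i) y) ≡ ∑< (suc s) x *ℕ ∑< s y
∑<-by-parts x y zero    = sym (ℕ.*-zeroʳ (∑< 1 x))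
∑<-by-parts x y (suc s) = begin
  ∑< (suc s) F +ℕ ∑< (suc s) G
    ≡⟨ cong₂ _+ℕ_ (∑<-init-last s F) (∑<-init-last s G) ⟩
  (∑< s F +ℕ X *ℕ y s) +ℕ (∑< s G +ℕ x (suc s) *ℕ ∑< (suc s) y)
    ≡⟨ cong (λ z → (∑< s F +ℕ X *ℕ y s) +ℕ (∑< s G +ℕ x (suc s) *ℕ z)) (∑<-init-last s y) ⟩
  (∑< s F +ℕ X *ℕ y s) +ℕ (∑< s G +ℕ x (suc s) *ℕ (∑< s y +ℕ y s))
    ≡⟨ regroup (∑< s F) (∑< s G) X (x (suc s)) (∑< s y) (y s) ⟩
  (∑< s F +ℕ ∑< s G) +ℕ (X *ℕ y s +ℕ x (suc s) *ℕ (∑< s y +ℕ y s))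
    ≡⟨ cong (_+ℕ (X *ℕ y s +ℕ x (suc s) *ℕ (∑< s y +ℕ y s))) (∑<-by-parts x y s) ⟩
  X *ℕ ∑< s y +ℕ (X *ℕ y s +ℕ x (suc s) *ℕ (∑< s y +ℕ y s))
    ≡⟨ factor X (x (suc s)) (∑< s y) (y s) ⟩
  (X +ℕ x (suc s)) *ℕ (∑< s y +ℕ y s)
    ≡⟨ sym (cong₂ _*ℕ_ (∑<-init-last (suc s) x) (∑<-init-last s y)) ⟩
  ∑< (suc (suc s)) x *ℕ ∑< (suc s) y ∎
  where
  open ≡-Reasoning
  F G : ℕ → ℕ
  F i = ∑< (suc i) x *ℕ y i
  G i = x (suc i) *ℕ ∑< (suc i) y
  X : ℕ
  X = ∑< (suc s) x
  regroup : ∀ f g a b c d → (f +ℕ a *ℕ d) +ℕ (g +ℕ b *ℕ (c +ℕ d)) ≡ (f +ℕ g) +ℕ (a *ℕ d +ℕ b *ℕ (c +ℕ d))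
  regroup = ℕ-Solver.solve-∀
  factor : ∀ a b c d → a *ℕ c +ℕ (a *ℕ d +ℕ b *ℕ (c +ℕ d)) ≡ (a +ℕ b) *ℕ (c +ℕ d)
  factor = ℕ-Solver.solve-∀

pairing : ℕ → ℕ → ℕ → ℕ
pairing s k j = ∑< s (λ i → column (suc s) k (s ∸ i) *ℕ column s j i)

Tbar-product : ∀ s k j → Tbar k (suc s) *ℕ Tbar j s ≡ pairing s (suc k) j +ℕ pairing s k (suc j)
Tbar-product s k j = begin
  Tbar k (suc s) *ℕ Tbar j s
    ≡⟨ cong₂ _*ℕ_ (Tbar≡∑<column (suc s) k) (Tbar≡∑<column s j) ⟩
  ∑< (suc s) x *ℕ ∑< s y
    ≡⟨ sym (∑<-by-parts x y s) ⟩
  ∑< s (λ i → ∑< (suc i) x *ℕ y i) +ℕ ∑< s (λ i → x (suc i) *ℕ ∑< (suc i) y)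
    ≡⟨ sym (cong₂ _+ℕ_ pairing-sucˡ pairing-sucʳ) ⟩
  pairing s (suc k) j +ℕ pairing s k (suc j) ∎
  where
  open ≡-Reasoning
  x = column (suc s) k
  y = column s j
  pairing-sucˡ : pairing s (suc k) j ≡ ∑< s (λ i → ∑< (suc i) x *ℕ y i)
  pairing-sucˡ = ∑<-cong s (λ i i<s → cong (λ r → ∑< r x *ℕ y i)
    (trans (ℕ.+-∸-assoc 1 (ℕ.m∸n≤m s i)) (cong suc (ℕ.m∸[m∸n]≡n (ℕ.<⇒≤ i<s)))))
  pairing-sucʳ : pairing s k (suc j) ≡ ∑< s (λ i → x (suc i) *ℕ ∑< (suc i) y)
  pairing-sucʳ = trans (∑<-reverse s (λ i → x (s ∸ i) *ℕ ∑< (s ∸ i) y))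
    (∑<-cong s (λ i i<s → cong (λ r → x r *ℕ ∑< r y) (ℕ.m∸[m∸n]≡n i<s)))

pairing-zeroˡ : ∀ s j → pairing s 0 j ≡ 0
pairing-zeroˡ s j = ∑<-zero s (λ i i<s →
  cong (λ r → column (suc s) 0 r *ℕ column s j i) (sym (suc[m∸1+n]≡m∸n s i i<s)))

column-suc-last : ∀ m k → column (suc m) (suc k) m ≡ column (suc m) k 0
column-suc-last m k = begin
  ∑< (suc m ∸ m) (column (suc m) k) ≡⟨ cong (λ r → ∑< r (column (suc m) k)) (ℕ.m+n∸n≡m 1 m) ⟩
  column (suc m) k 0 +ℕ 0           ≡⟨ ℕ.+-identityʳ _ ⟩
  column (suc m) k 0                ∎
  where open ≡-Reasoning

pairing-zeroʳ : ∀ p n → pairing (suc p) (suc (suc n)) 0 ≡ Tbar n (suc (suc p))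
pairing-zeroʳ p n = begin
  column m (2 +ℕ n) (suc p) *ℕ 1 +ℕ ∑< p (λ i → column m (2 +ℕ n) (p ∸ i) *ℕ 0)
    ≡⟨ cong₂ _+ℕ_ (ℕ.*-identityʳ _) (∑<-zero p (λ i _ → ℕ.*-zeroʳ (column m (2 +ℕ n) (p ∸ i)))) ⟩
  column m (2 +ℕ n) (suc p) +ℕ 0
    ≡⟨ ℕ.+-identityʳ _ ⟩
  column m (2 +ℕ n) (suc p)
    ≡⟨ column-suc-last (suc p) (suc n) ⟩
  ∑< m (column m n)
    ≡⟨ sym (Tbar≡∑<column m n) ⟩
  Tbar n m ∎
  where
  open ≡-Reasoning
  m = suc (suc p)

Σℤ≤-cong : ∀ n {f g : ℕ → ℤ} → (∀ k → k ≤ n → f k ≡ g k) → Σℤ≤ n f ≡ Σℤ≤ n g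
Σℤ≤-cong zero    f≗g = f≗g 0 z≤n
Σℤ≤-cong (suc n) f≗g = cong₂ _+_ (Σℤ≤-cong n (λ k k≤n → f≗g k (ℕ.m≤n⇒m≤1+n k≤n))) (f≗g (suc n) ℕ.≤-refl)

Σℤ≤-neg : ∀ n (f : ℕ → ℤ) → Σℤ≤ n (λ k → - f k) ≡ - Σℤ≤ n f
Σℤ≤-neg zero    f = refl
Σℤ≤-neg (suc n) f = trans (cong (_+ - f (suc n)) (Σℤ≤-neg n f)) (sym (ℤ.neg-distrib-+ (Σℤ≤ n f) (f (suc n))))

sign-suc : ∀ k → sign (suc k) ≡ - sign k
sign-suc zero          = refl
sign-suc (suc zero)    = refl
sign-suc (suc (suc k)) = sign-suc k

alternating-telescope : ∀ (a : ℕ → ℤ) n →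
  Σℤ≤ n (λ k → sign (n ∸ k) * (a (suc k) + a k)) ≡ a (suc n) + sign n * a 0
alternating-telescope a zero    = trans (ℤ.*-identityˡ _) (cong (λ z → a 1 + z) (sym (ℤ.*-identityˡ (a 0))))
alternating-telescope a (suc n) = begin
  Σℤ≤ n (λ k → sign (suc n ∸ k) * (a (suc k) + a k)) + sign (n ∸ n) * (a (2 +ℕ n) + a (suc n))
    ≡⟨ cong₂ _+_ (Σℤ≤-cong n flip-sign) (cong (λ r → sign r * (a (2 +ℕ n) + a (suc n))) (ℕ.n∸n≡0 n)) ⟩
  Σℤ≤ n (λ k → - (sign (n ∸ k) * (a (suc k) + a k))) + 1ℤ * (a (2 +ℕ n) + a (suc n))
    ≡⟨ cong (_+ 1ℤ * (a (2 +ℕ n) + a (suc n))) (trans (Σℤ≤-neg n _) (cong -_ (alternating-telescope a n))) ⟩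
  - (a (suc n) + sign n * a 0) + 1ℤ * (a (2 +ℕ n) + a (suc n))
    ≡⟨ cancel (a (suc n)) (sign n) (a 0) (a (2 +ℕ n)) ⟩
  a (2 +ℕ n) + (- sign n) * a 0
    ≡⟨ cong (λ σ → a (2 +ℕ n) + σ * a 0) (sym (sign-suc n)) ⟩
  a (2 +ℕ n) + sign (suc n) * a 0 ∎
  where
  open ≡-Reasoning
  flip-sign : ∀ k → k ≤ n → sign (suc n ∸ k) * (a (suc k) + a k) ≡ - (sign (n ∸ k) * (a (suc k) + a k))
  flip-sign k k≤n = begin
    sign (suc n ∸ k) * (a (suc k) + a k)    ≡⟨ cong (λ r → sign r * (a (suc k) + a k)) (ℕ.+-∸-assoc 1 k≤n) ⟩
    sign (suc (n ∸ k)) * (a (suc k) + a k)  ≡⟨ cong (_* (a (suc k) + a k)) (sign-suc (n ∸ k)) ⟩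
    - sign (n ∸ k) * (a (suc k) + a k)      ≡⟨ sym (ℤ.neg-distribˡ-* (sign (n ∸ k)) _) ⟩
    - (sign (n ∸ k) * (a (suc k) + a k))    ∎
  cancel : ∀ b σ c d → - (b + σ * c) + 1ℤ * (d + b) ≡ d + (- σ) * c
  cancel = ℤ-Solver.solve-∀

corollary3p11 : (m n : ℕ) → 2 ≤ m → 2 ≤ n →
    + Tbar (n ∸ 1) m ≡ Σℤ≤ n (λ k → sign (n ∸ k) * (+ Tbar k m) * (+ Tbar (n ∸ k) (m ∸ 1)))
corollary3p11 (suc (suc p)) (suc N) (s≤s (s≤s _)) _ = sym (begin
  Σℤ≤ n (λ k → sign (n ∸ k) * (+ Tbar k m) * (+ Tbar (n ∸ k) s))
    ≡⟨ Σℤ≤-cong n summand ⟩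
  Σℤ≤ n (λ k → sign (n ∸ k) * (a (suc k) + a k))
    ≡⟨ alternating-telescope a n ⟩
  a (suc n) + sign n * + pairing s 0 (suc n)
    ≡⟨ cong (λ z → a (suc n) + sign n * + z) (pairing-zeroˡ s (suc n)) ⟩
  a (suc n) + sign n * 0ℤ
    ≡⟨ trans (cong (λ z → a (suc n) + z) (ℤ.*-zeroʳ (sign n))) (ℤ.+-identityʳ (a (suc n))) ⟩
  + pairing s (suc n) (n ∸ n)
    ≡⟨ cong (λ r → + pairing s (suc n) r) (ℕ.n∸n≡0 n) ⟩
  + pairing s (suc n) 0
    ≡⟨ cong +_ (pairing-zeroʳ p N) ⟩
  + Tbar N m ∎)
  where
  open ≡-Reasoning
  m = suc (suc p)
  s = suc p
  n = suc N
  a : ℕ → ℤ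
  a k = + pairing s k (suc n ∸ k)
  summand : ∀ k → k ≤ n → sign (n ∸ k) * (+ Tbar k m) * (+ Tbar (n ∸ k) s) ≡ sign (n ∸ k) * (a (suc k) + a k)
  summand k k≤n = trans (ℤ.*-assoc (sign (n ∸ k)) _ _) (cong (sign (n ∸ k) *_) (begin
    + Tbar k m * + Tbar (n ∸ k) s
      ≡⟨ sym (ℤ.pos-* (Tbar k m) (Tbar (n ∸ k) s)) ⟩
    + (Tbar k m *ℕ Tbar (n ∸ k) s)
      ≡⟨ cong +_ (Tbar-product s k (n ∸ k)) ⟩
    + (pairing s (suc k) (n ∸ k) +ℕ pairing s k (suc (n ∸ k)))
      ≡⟨ ℤ.pos-+ (pairing s (suc k) (n ∸ k)) _ ⟩
    a (suc k) + + pairing s k (suc (n ∸ k))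
      ≡⟨ cong (λ r → a (suc k) + + pairing s k r) (sym (ℕ.+-∸-assoc 1 k≤n)) ⟩
    a (suc k) + a k ∎))
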